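{- Let $(D=(V,A),\mathcal F)$ be a digraft, and suppose $\delta^+(U)$ is a contractible dicut. Let $(D_i=(V_i,A_i),\mathcal F_i)$, $i=1,2$, be the $(U,V\setminus U)$-contractions of $(D,\mathcal F)$. Then: (1) (Decomposition) for $i\in \{1,2\}$, $(D_i,\mathcal F_i)$ is a digraft; furthermore, if $J\subseteq A$ satisfies $\mathbf{1}_J\in F(D,\mathcal F)\cap \{x:x(\delta^+(U))=1\}$, then $J_i:=J\cap A_i$ satisfies $\mathbf{1}_{J_i}\in F(D_i,\mathcal F_i)$; (2) (Composition) if $J_i\subseteq A_i$ satisfies $\mathbf{1}_{J_i}\in F(D_i,\mathcal F_i)$ for $i=1,2$, and $J_1\cap \delta^+(U)=J_2\cap \delta^+(U)$, then $J:=J_1\cup J_2$ satisfies $\mathbf{1}_J\in F(D,\mathcal F)\cap \{x:x(\delta^+(U))=1\}$.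
   Context: $\delta^+(W),\delta^-(W)$ are arcs leaving/entering $W$; $x(S)=\sum_{a\in S}x_a$; $\mathbf 1_J$ is an indicator vector. A dicut is $\delta^+(W)$ with $\emptyset\ne W\subsetneq V$, $\delta^-(W)=\emptyset$. $\mathrm{dij}(D)=\{x\ge0:x(\delta^+(W))\ge1$ for every dicut$\}$. A digraph is bipartite if every node is a source or a sink. A digraft is a pair $(D,\mathcal F)$ with $D=(V,A)$ bipartite with $2$-edge-connected underlying undirected graph, and $\mathcal F$ a family of subsets of $V$ with (a) $\emptyset,V\notin\mathcal F$, (b) $\delta^-(W)=\emptyset$ for $W\in\mathcal F$, (c) $V\setminus\{v\}\in\mathcal F$ for every sink $v$, (d) $F(D,\mathcal F):=\mathrm{dij}(D)\cap\{x:x(\delta^+(W))=1\ \forall W\in\mathcal F\}\neq\emptyset$. A dicut $\delta^+(U)$ is contractible if $1<|U|<|V|-1$ and $F(D,\mathcal F)\cap\{x:x(\delta^+(U))=1\}\neq\emptyset$. Contractions: let $\overline{\mathcal F}$ be the family of all $W$ with $\emptyset\ne W\subsetneq V$, $\delta^-(W)=\emptyset$ and $F(D,\mathcal F\cup\{U\})\subseteq\{x:x(\delta^+(W))=1\}$. With $U_1=U,U_2=V\setminus U$, $D_i=(V_i,A_i)$ is obtained from $D$ by shrinking $U_i$ to a new node $u_i$: $V_i=\{u_i\}\cup U_{3-i}$, arcs with both ends in $U_i$ are deleted, and arc ends in $U_i$ are replaced by $u_i$; arcs of $A_i$ are identified with the corresponding arcs of $A$, so $A_i\subseteq A$, $A_1\cap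 A_2=\delta^+(U)$, $A_1\cup A_2=A$. $\mathcal F_i=\{W\in\overline{\mathcal F}:W\cap U_i=\emptyset\}\cup\{(W\setminus U_i)\cup\{u_i\}:W\in\overline{\mathcal F},U_i\subseteq W\}$.
   Formalization: The vectors x in dij(D) and F(D,𝓕), including the witnesses of nonemptiness for digraft and contractible dicut and those defining $\overline{\mathcal F}$, are taken in ℚ. -}

module Defs where

open import Data.Nat using (ℕ; zero; suc; _<_; _∸_)
open import Data.Fin using (Fin)
open import Data.Fin.Subset using (Subset; _∈_; _∉_; _⊆_; ∣_∣; ∁; ⁅_⁆; _∩_; _∪_; Empty; Nonempty; ⊤; ⊥)
open import Data.Vec using (lookup)
open import Data.Bool using (Bool; true; false; _∧_; not; if_then_else_)
open import Data.Rational using (ℚ; 0ℚ; 1ℚ; _+_; _≤_)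
open import Data.Product using (Σ; ∃; _×_; _,_)
open import Data.Sum using (_⊎_)
open import Relation.Binary.PropositionalEquality using (_≡_; _≢_)
open import Relation.Nullary using (¬_)
open import Function.Bundles using (_⇔_)

-- Finite directed multigraphs: nodes Fin n, arcs Fin m (arcs are
-- distinguishable objects, parallel arcs allowed).

record Digraph (n m : ℕ) : Set where
  field
    tail : Fin m → Fin n
    head : Fin m → Fin n
open Digraph public

sumFin : {m : ℕ} → (Fin m → ℚ) → ℚ
sumFin {zero}  f = 0ℚ
sumFin {suc m} f = f Fin.zero + sumFin {m} (λ i → f (Fin.suc i))

xsum : {m : ℕ} → (Fin m → ℚ) → (Fin m → Bool) → ℚ
xsum x S = sumFin (λ a → if S a then x a else 0ℚ)

indicator : {m : ℕ} → Subset m → Fin m → ℚ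
indicator J a = if lookup J a then 1ℚ else 0ℚ

module _ {n m : ℕ} (D : Digraph n m) where

  leaves? : Subset n → Fin m → Bool
  leaves? W a = lookup W (tail D a) ∧ not (lookup W (head D a))

  enters? : Subset n → Fin m → Bool
  enters? W a = lookup W (head D a) ∧ not (lookup W (tail D a))

  NoEntering : Subset n → Set
  NoEntering W = (a : Fin m) → enters? W a ≡ false

  NonemptyProper : Subset n → Set
  NonemptyProper W = Nonempty W × Nonempty (∁ W)

  IsDicut : Subset n → Set
  IsDicut W = NonemptyProper W × NoEntering W

  xout : (Fin m → ℚ) → Subset n → ℚ
  xout x W = xsum x (leaves? W)

  Dij : (Fin m → ℚ) → Set
  Dij x = ((a : Fin m) → 0ℚ ≤ x a) × ((W : Subset n) → IsDicut W → 1ℚ ≤ xout x W)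

  FF : (Subset n → Set) → (Fin m → ℚ) → Set
  FF 𝓕 x = Dij x × ((W : Subset n) → 𝓕 W → xout x W ≡ 1ℚ)

  IsSource : Fin n → Set
  IsSource v = (a : Fin m) → head D a ≢ v

  IsSink : Fin n → Set
  IsSink v = (a : Fin m) → tail D a ≢ v

  Bipartite : Set
  Bipartite = (v : Fin n) → IsSource v ⊎ IsSink v

  data Walk (P : Fin m → Set) : Fin n → Fin n → Set where
    here : (v : Fin n) → Walk P v v
    fwd  : (a : Fin m) → P a → {w : Fin n} → Walk P (head D a) w → Walk P (tail D a) w
    bwd  : (a : Fin m) → P a → {w : Fin n} → Walk P (tail D a) w → Walk P (head D a) w

  TwoEdgeConnected : Set
  TwoEdgeConnected =
    ((u v : Fin n) → Walk (λ _ → Data.Unit.⊤) u v) ×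
    ((e : Fin m) (u v : Fin n) → Walk (λ a → a ≢ e) u v)
    where import Data.Unit

  IsDigraft : (Subset n → Set) → Set
  IsDigraft 𝓕 =
    Bipartite × TwoEdgeConnected ×
    ¬ 𝓕 ⊥ × ¬ 𝓕 ⊤ ×
    ((W : Subset n) → 𝓕 W → NoEntering W) ×
    ((v : Fin n) → IsSink v → 𝓕 (∁ ⁅ v ⁆)) ×
    (∃ λ x → FF 𝓕 x)

  Contractible : (Subset n → Set) → Subset n → Set
  Contractible 𝓕 U =
    IsDicut U × 1 < ∣ U ∣ × ∣ U ∣ < n ∸ 1 ×
    (∃ λ x → FF 𝓕 x × xout x U ≡ 1ℚ)

  addSet : (Subset n → Set) → Subset n → Subset n → Set
  addSet 𝓕 U W = 𝓕 W ⊎ W ≡ U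

  FBar : (Subset n → Set) → Subset n → Subset n → Set
  FBar 𝓕 U W =
    NonemptyProper W × NoEntering W ×
    ((x : Fin m → ℚ) → FF (addSet 𝓕 U) x → xout x W ≡ 1ℚ)

-- (D', 𝓕') is obtained from (D, 𝓕) by shrinking the node set S to a new
-- node u, where U is the contractible dicut shore.  The data are: a node
-- map φ : V → V' (sending S to u and identifying V∖S with V'∖{u}) and an
-- arc map ψ : A' → A identifying A' with the arcs of A not having both
-- ends in S.
record IsShrinking {n m n' m' : ℕ} (D : Digraph n m) (𝓕 : Subset n → Set)
                   (U S : Subset n)
                   (D' : Digraph n' m') (𝓕' : Subset n' → Set)
                   (φ : Fin n → Fin n') (ψ : Fin m' → Fin m) (u : Fin n') : Set where
  field
    φ-S      : (v : Fin n) → v ∈ S → φ v ≡ u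
    φ-out    : (v : Fin n) → v ∉ S → φ v ≢ u
    φ-inj    : (v w : Fin n) → v ∉ S → w ∉ S → φ v ≡ φ w → v ≡ w
    φ-surj   : (v' : Fin n') → v' ≢ u → Σ (Fin n) λ v → v ∉ S × φ v ≡ v'
    ψ-inj    : (b c : Fin m') → ψ b ≡ ψ c → b ≡ c
    ψ-image  : (a : Fin m) → (∃ λ b → ψ b ≡ a) ⇔ (¬ (tail D a ∈ S × head D a ∈ S))
    tail-ψ   : (b : Fin m') → tail D' b ≡ φ (tail D (ψ b))
    head-ψ   : (b : Fin m') → head D' b ≡ φ (head D (ψ b))
    -- 𝓕' = {W : W ∈ 𝓕̄, W ∩ S = ∅} ∪ {(W ∖ S) ∪ {u} : W ∈ 𝓕̄, S ⊆ W},
    -- i.e. the images φ[W] of those W ∈ 𝓕̄ with W ∩ S = ∅ or S ⊆ W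
    𝓕'-char  : (W' : Subset n') → 𝓕' W' ⇔
                 (∃ λ W → FBar D 𝓕 U W × (Empty (W ∩ S) ⊎ S ⊆ W) ×
                   ((v' : Fin n') → v' ∈ W' ⇔ (∃ λ v → v ∈ W × φ v ≡ v')))

-- Shrinking a node set S to a node u (the map φ) identifies the dicut shores of the
-- contraction with the saturated dicut shores W of D, i.e. unions of fibres of φ (W ∩ S = ∅
-- or S ⊆ W), and restricting x to the surviving arcs (along ψ) preserves x(δ⁺W) on them.
-- Decomposition follows by restricting a point of F(D, 𝓕 ∪ {U}). For composition, a
-- shore W that is saturated for neither contraction has W ∩ U saturated for the
-- contraction of V∖U and W ∪ U saturated for that of U, and the uncrossing identity
-- x(δ⁺W) + x(δ⁺U) = x(δ⁺(W ∩ U)) + x(δ⁺(W ∪ U)) together with x(δ⁺U) = 1 transfers the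
-- dicut inequality, and for W ∈ 𝓕 the equality, from W ∩ U and W ∪ U to W. The same
-- identity shows that 𝓕̄ is closed under uncrossing, so W ∩ U, W ∪ U ∈ 𝓕̄ when W ∈ 𝓕.

module Submission where

open import Defs
open import Data.Nat using (ℕ; zero; suc)
open import Data.Fin using (Fin; zero; suc)
open import Data.Fin.Properties using (any?; suc-injective) renaming (_≟_ to _≟ᶠ_)
open import Data.Fin.Subset using (Subset; _∈_; _∉_; _⊆_; ∁; ⁅_⁆; _∩_; _∪_; Empty; Nonempty; ⊤; ⊥)
open import Data.Fin.Subset.Properties
  using (_∈?_; nonempty?; Empty-unique; ⊆-antisym; ⊆⊤; ∉⊥; ∈⊤; x∈p⇒x∉∁p; x∈∁p⇒x∉p; x∉p⇒x∈∁p; x∉∁p⇒x∈p;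
         x∈p∩q⁺; x∈p∩q⁻; x∈p∪q⁻; p⊆p∪q; q⊆p∪q; x≢y⇒x∉⁅y⁆; x∉⁅y⁆⇒x≢y)
open import Data.Vec using (lookup; tabulate)
open import Data.Vec.Properties using (lookup-zipWith; lookup∘tabulate; []=⇒lookup; lookup⇒[]=)
open import Data.Bool.Properties using (¬-not; not-¬; ⇔→≡; ∧-inverseʳ; T-≡) renaming (_≟_ to _≟ᵇ_)
open import Data.Bool using (true; false; _∧_; _∨_; not; if_then_else_)
open import Data.Rational using (ℚ; 0ℚ; 1ℚ; _+_; _≤_; -_)
open import Data.Rational.Properties
  using (+-0-commutativeMonoid; +-0-group; +-identityˡ; +-identityʳ; +-comm; 1≢0;
         +-mono-≤; +-monoˡ-≤; +-monoʳ-≤; ≤-antisym; ≤-trans; ≤-reflexive)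
open import Data.Unit using (tt)
open import Data.Empty using (⊥-elim)
open import Data.Product using (∃; _×_; _,_; proj₁; proj₂)
open import Data.Sum using (_⊎_; inj₁; inj₂; [_,_]′)
open import Relation.Binary.PropositionalEquality
open import Relation.Nullary using (¬_; Dec; yes; no; does; isYes; contradiction)
open import Relation.Nullary.Decidable using (_×-dec_; decidable-stable; toWitness; fromWitness)
open import Function.Base using (_∘_; case_of_)
open import Function.Definitions using (Injective)
open import Function.Bundles using (_⇔_; mk⇔; Equivalence)
open Equivalence using (to; from)
open import Algebra.Properties.CommutativeMonoid.Sum +-0-commutativeMonoid
  using (sum; sum-syntax; sum-cong-≗; ∑-comm; ∑-distrib-+; sum-replicate-zero)
open import Algebra.Properties.Group +-0-group using (//-rightDividesʳ; ∙-cancelʳ)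

sumFin≡sum : ∀ {k} (f : Fin k → ℚ) → sumFin f ≡ sum f
sumFin≡sum {zero}  f = refl
sumFin≡sum {suc k} f = cong (f zero +_) (sumFin≡sum (λ i → f (suc i)))

sum-zero : ∀ {k} (f : Fin k → ℚ) → (∀ i → f i ≡ 0ℚ) → sum f ≡ 0ℚ
sum-zero {k} f f≗0 = trans (sum-cong-≗ f≗0) (sum-replicate-zero k)

sum-single : ∀ {k} (f : Fin k → ℚ) i → (∀ j → j ≢ i → f j ≡ 0ℚ) → sum f ≡ f i
sum-single {suc k} f zero f≗0 =
  trans (cong (f zero +_) (sum-zero _ (λ j → f≗0 (suc j) λ ()))) (+-identityʳ (f zero))
sum-single {suc k} f (suc i) f≗0 =
  trans (cong (_+ sum (λ j → f (suc j))) (f≗0 zero λ ()))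
        (trans (+-identityˡ _) (sum-single (λ j → f (suc j)) i (λ j j≢i → f≗0 (suc j) (j≢i ∘ suc-injective))))

sumFin-cong : ∀ {k} {f g : Fin k → ℚ} → f ≗ g → sumFin f ≡ sumFin g
sumFin-cong {f = f} {g} f≗g = trans (sumFin≡sum f) (trans (sum-cong-≗ f≗g) (sym (sumFin≡sum g)))

sumFin-+ : ∀ {k} (f g : Fin k → ℚ) → sumFin (λ i → f i + g i) ≡ sumFin f + sumFin g
sumFin-+ f g = trans (sumFin≡sum (λ i → f i + g i)) (trans (∑-distrib-+ f g) (sym (cong₂ _+_ (sumFin≡sum f) (sumFin≡sum g))))

sumFin-zero : ∀ {k} (f : Fin k → ℚ) → (∀ i → f i ≡ 0ℚ) → sumFin f ≡ 0ℚ
sumFin-zero f f≗0 = trans (sumFin≡sum f) (sum-zero f f≗0)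

-- Both sides equal the double sum of f a over the pairs (b , a) with ψ b ≡ a.
sum-reindex : ∀ {k l} (ψ : Fin k → Fin l) → Injective _≡_ _≡_ ψ → (f : Fin l → ℚ) →
              (∀ a → (∀ b → ψ b ≢ a) → f a ≡ 0ℚ) → sum (f ∘ ψ) ≡ sum f
sum-reindex {k} {l} ψ ψ-inj f f-outside = begin
  sum (f ∘ ψ)                        ≡⟨ sum-cong-≗ (λ b → sym (row b)) ⟩
  ∑[ b < k ] ∑[ a < l ] graph b a    ≡⟨ ∑-comm graph ⟩
  ∑[ a < l ] ∑[ b < k ] graph b a    ≡⟨ sum-cong-≗ column ⟩
  sum f                              ∎
  where
  open ≡-Reasoning
  graph : Fin k → Fin l → ℚ
  graph b a = if does (ψ b ≟ᶠ a) then f a else 0ℚ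
  graph-off : ∀ {b a} → ψ b ≢ a → graph b a ≡ 0ℚ
  graph-off {b} {a} ψb≢a with ψ b ≟ᶠ a
  ... | yes ψb≡a = contradiction ψb≡a ψb≢a
  ... | no _     = refl
  graph-on : ∀ {b a} → ψ b ≡ a → graph b a ≡ f a
  graph-on {b} {a} ψb≡a with ψ b ≟ᶠ a
  ... | yes _    = refl
  ... | no ψb≢a  = contradiction ψb≡a ψb≢a
  row : ∀ b → ∑[ a < l ] graph b a ≡ f (ψ b)
  row b = trans (sum-single (graph b) (ψ b) (λ a a≢ψb → graph-off (a≢ψb ∘ sym))) (graph-on refl)
  column : ∀ a → ∑[ b < k ] graph b a ≡ f a
  column a with any? (λ b → ψ b ≟ᶠ a)
  ... | yes (b₀ , ψb₀≡a) = trans (sum-single (λ b → graph b a) b₀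
                                   (λ b b≢b₀ → graph-off (λ ψb≡a → b≢b₀ (ψ-inj (trans ψb≡a (sym ψb₀≡a))))))
                                 (graph-on ψb₀≡a)
  ... | no  ∄b           = trans (sum-zero _ (λ b → graph-off (λ ψb≡a → ∄b (b , ψb≡a))))
                                 (sym (f-outside a (λ b ψb≡a → ∄b (b , ψb≡a))))

sumFin-reindex : ∀ {k l} (ψ : Fin k → Fin l) → Injective _≡_ _≡_ ψ → (f : Fin l → ℚ) →
                 (∀ a → (∀ b → ψ b ≢ a) → f a ≡ 0ℚ) → sumFin (f ∘ ψ) ≡ sumFin f
sumFin-reindex ψ ψ-inj f f-outside =
  trans (sumFin≡sum (f ∘ ψ)) (trans (sum-reindex ψ ψ-inj f f-outside) (sym (sumFin≡sum f)))

+-cancelʳ-≤ : ∀ a b c → a + c ≤ b + c → a ≤ b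
+-cancelʳ-≤ a b c a+c≤b+c =
  subst₂ _≤_ (//-rightDividesʳ c a) (//-rightDividesʳ c b) (+-monoˡ-≤ (- c) a+c≤b+c)

-- a, b, c, d stand for x(δ⁺W), x(δ⁺X), x(δ⁺(W ∩ X)), x(δ⁺(W ∪ X)) with X tight.
module _ {a b c d : ℚ} (a+b≡c+d : a + b ≡ c + d) (b≡1 : b ≡ 1ℚ) where

  1≤-of-uncrossing : 1ℚ ≤ c → 1ℚ ≤ d → 1ℚ ≤ a
  1≤-of-uncrossing 1≤c 1≤d = +-cancelʳ-≤ 1ℚ a 1ℚ
    (≤-trans (+-mono-≤ 1≤c 1≤d) (≤-reflexive (trans (sym a+b≡c+d) (cong (a +_) b≡1))))

  ≡1-of-uncrossing : c ≡ 1ℚ → d ≡ 1ℚ → a ≡ 1ℚ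
  ≡1-of-uncrossing c≡1 d≡1 =
    ∙-cancelʳ 1ℚ a 1ℚ (trans (cong (a +_) (sym b≡1)) (trans a+b≡c+d (cong₂ _+_ c≡1 d≡1)))

  module _ (a≡1 : a ≡ 1ℚ) (1≤c : 1ℚ ≤ c) (1≤d : 1ℚ ≤ d) where

    private
      c+d≡1+1 : c + d ≡ 1ℚ + 1ℚ
      c+d≡1+1 = trans (sym a+b≡c+d) (cong₂ _+_ a≡1 b≡1)

    ≡1-of-uncrossingˡ : c ≡ 1ℚ
    ≡1-of-uncrossingˡ = ≤-antisym
      (+-cancelʳ-≤ c 1ℚ 1ℚ (≤-trans (+-monoʳ-≤ c 1≤d) (≤-reflexive c+d≡1+1)))
      1≤c

    ≡1-of-uncrossingʳ : d ≡ 1ℚ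
    ≡1-of-uncrossingʳ = ≤-antisym
      (+-cancelʳ-≤ d 1ℚ 1ℚ (≤-trans (≤-reflexive (+-comm d 1ℚ)) (≤-trans (+-monoˡ-≤ d 1≤c) (≤-reflexive c+d≡1+1))))
      1≤d

∉⇒lookup≡false : ∀ {k} {W : Subset k} {v} → v ∉ W → lookup W v ≡ false
∉⇒lookup≡false {W = W} {v} v∉W = ¬-not (v∉W ∘ lookup⇒[]= v W)

lookup≡false⇒∉ : ∀ {k} {W : Subset k} {v} → lookup W v ≡ false → v ∉ W
lookup≡false⇒∉ W[v]≡false v∈W = not-¬ ([]=⇒lookup v∈W) W[v]≡false

lookup-∩ : ∀ {k} (W X : Subset k) v → lookup (W ∩ X) v ≡ lookup W v ∧ lookup X v
lookup-∩ W X v = lookup-zipWith _∧_ v W X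

lookup-∪ : ∀ {k} (W X : Subset k) v → lookup (W ∪ X) v ≡ lookup W v ∨ lookup X v
lookup-∪ W X v = lookup-zipWith _∨_ v W X

∈∁⁅⁆⁺ : ∀ {k} {v w : Fin k} → w ≢ v → w ∈ ∁ ⁅ v ⁆
∈∁⁅⁆⁺ = x∉p⇒x∈∁p ∘ x≢y⇒x∉⁅y⁆

∈∁⁅⁆⁻ : ∀ {k} {v w : Fin k} → w ∈ ∁ ⁅ v ⁆ → w ≢ v
∈∁⁅⁆⁻ = x∉⁅y⁆⇒x≢y ∘ x∈∁p⇒x∉p

-- wt, wh (xt, xh) record whether the tail and the head of an arc lie in W (in X).
if-leaves-modular : ∀ wt wh xt xh (q : ℚ) → wh ∧ not wt ≡ false → xh ∧ not xt ≡ false →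
  (if wt ∧ not wh then q else 0ℚ) + (if xt ∧ not xh then q else 0ℚ) ≡
  (if (wt ∧ xt) ∧ not (wh ∧ xh) then q else 0ℚ) + (if (wt ∨ xt) ∧ not (wh ∨ xh) then q else 0ℚ)
if-leaves-modular false true  _     _     _ () _
if-leaves-modular _     _     false true  _ _  ()
if-leaves-modular false false false false _ _ _ = refl
if-leaves-modular false false true  false _ _ _ = refl
if-leaves-modular false false true  true  _ _ _ = refl
if-leaves-modular true  false false false q _ _ = +-comm q 0ℚ
if-leaves-modular true  false true  false _ _ _ = refl
if-leaves-modular true  false true  true  _ _ _ = refl
if-leaves-modular true  true  false false _ _ _ = refl
if-leaves-modular true  true  true  false q _ _ = +-comm 0ℚ q
if-leaves-modular true  true  true  true  _ _ _ = refl

∧-enters-closed : ∀ wt wh xt xh → wh ∧ not wt ≡ false → xh ∧ not xt ≡ false → (wh ∧ xh) ∧ not (wt ∧ xt) ≡ false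
∧-enters-closed _     false _     _     _  _  = refl
∧-enters-closed _     true  _     false _  _  = refl
∧-enters-closed true  true  true  true  _  _  = refl
∧-enters-closed false true  _     true  () _
∧-enters-closed true  true  false true  _  ()

∨-enters-closed : ∀ wt wh xt xh → wh ∧ not wt ≡ false → xh ∧ not xt ≡ false → (wh ∨ xh) ∧ not (wt ∨ xt) ≡ false
∨-enters-closed _     false _     false _  _  = refl
∨-enters-closed true  true  _     _     _  _  = refl
∨-enters-closed false true  _     _     () _
∨-enters-closed true  false _     true  _  _  = refl
∨-enters-closed false false true  true  _  _  = refl
∨-enters-closed _     false false true  _  ()

module _ {n m : ℕ} (D : Digraph n m) where

  leaves-cong : ∀ {W₁ W₂ : Subset n} → lookup W₁ ≗ lookup W₂ → leaves? D W₁ ≗ leaves? D W₂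
  leaves-cong W₁≗W₂ a = cong₂ (λ t h → t ∧ not h) (W₁≗W₂ (tail D a)) (W₁≗W₂ (head D a))

  NoEntering-cong : ∀ {W₁ W₂ : Subset n} → lookup W₁ ≗ lookup W₂ → NoEntering D W₁ → NoEntering D W₂
  NoEntering-cong W₁≗W₂ W₁-closed a =
    trans (cong₂ (λ h t → h ∧ not t) (sym (W₁≗W₂ (head D a))) (sym (W₁≗W₂ (tail D a)))) (W₁-closed a)

  NoEntering-head⇒tail : ∀ {W} → NoEntering D W → ∀ {a} → head D a ∈ W → tail D a ∈ W
  NoEntering-head⇒tail {W} W-closed {a} head∈W with tail D a ∈? W
  ... | yes tail∈W = tail∈W
  ... | no  tail∉W = contradiction
    (trans (sym (cong₂ (λ h t → h ∧ not t) ([]=⇒lookup head∈W) (∉⇒lookup≡false tail∉W))) (W-closed a)) λ ()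

  leaves?⁺ : ∀ {W a} → tail D a ∈ W → head D a ∉ W → leaves? D W a ≡ true
  leaves?⁺ tail∈W head∉W = cong₂ (λ t h → t ∧ not h) ([]=⇒lookup tail∈W) (∉⇒lookup≡false head∉W)

  leaves?⁻ : ∀ {W a} → leaves? D W a ≡ true → tail D a ∈ W × head D a ∉ W
  leaves?⁻ {W} {a} leaves with lookup W (tail D a) in tail∈W | lookup W (head D a) in head∉W
  leaves?⁻ {W} {a} () | false | _
  leaves?⁻ {W} {a} () | true  | true
  leaves?⁻ {W} {a} _  | true  | false = lookup⇒[]= (tail D a) W tail∈W , lookup≡false⇒∉ head∉W

  leaving-arc : ∀ x W → xout D x W ≢ 0ℚ → ∃ λ a → leaves? D W a ≡ true
  leaving-arc x W x[W]≢0 with any? (λ a → leaves? D W a ≟ᵇ true)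
  ... | yes leaving = leaving
  ... | no  ∄leaving = contradiction
    (sumFin-zero _ (λ a → cong (λ l → if l then x a else 0ℚ) (¬-not (∄leaving ∘ (a ,_))))) x[W]≢0

  xout-congˡ : ∀ {x y} W → x ≗ y → xout D x W ≡ xout D y W
  xout-congˡ W x≗y = sumFin-cong (λ a → cong (λ q → if leaves? D W a then q else 0ℚ) (x≗y a))

  xout-congʳ : ∀ x {W₁ W₂ : Subset n} → lookup W₁ ≗ lookup W₂ → xout D x W₁ ≡ xout D x W₂
  xout-congʳ x {W₁} {W₂} W₁≗W₂ =
    sumFin-cong (λ a → cong (λ l → if l then x a else 0ℚ) (leaves-cong {W₁} {W₂} W₁≗W₂ a))

  leaves-∩ : ∀ W X a → leaves? D (W ∩ X) a ≡
             (lookup W (tail D a) ∧ lookup X (tail D a)) ∧ not (lookup W (head D a) ∧ lookup X (head D a))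
  leaves-∩ W X a = cong₂ (λ t h → t ∧ not h) (lookup-∩ W X (tail D a)) (lookup-∩ W X (head D a))

  leaves-∪ : ∀ W X a → leaves? D (W ∪ X) a ≡
             (lookup W (tail D a) ∨ lookup X (tail D a)) ∧ not (lookup W (head D a) ∨ lookup X (head D a))
  leaves-∪ W X a = cong₂ (λ t h → t ∧ not h) (lookup-∪ W X (tail D a)) (lookup-∪ W X (head D a))

  NoEntering-∩ : ∀ W X → NoEntering D W → NoEntering D X → NoEntering D (W ∩ X)
  NoEntering-∩ W X W-closed X-closed a =
    trans (cong₂ (λ h t → h ∧ not t) (lookup-∩ W X (head D a)) (lookup-∩ W X (tail D a)))
          (∧-enters-closed (lookup W (tail D a)) (lookup W (head D a)) (lookup X (tail D a)) (lookup X (head D a))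
                           (W-closed a) (X-closed a))

  NoEntering-∪ : ∀ W X → NoEntering D W → NoEntering D X → NoEntering D (W ∪ X)
  NoEntering-∪ W X W-closed X-closed a =
    trans (cong₂ (λ h t → h ∧ not t) (lookup-∪ W X (head D a)) (lookup-∪ W X (tail D a)))
          (∨-enters-closed (lookup W (tail D a)) (lookup W (head D a)) (lookup X (tail D a)) (lookup X (head D a))
                           (W-closed a) (X-closed a))

  xout-modular : ∀ x W X → NoEntering D W → NoEntering D X →
                 xout D x W + xout D x X ≡ xout D x (W ∩ X) + xout D x (W ∪ X)
  xout-modular x W X W-closed X-closed = begin
    xout D x W + xout D x X                         ≡⟨ sumFin-+ (out W) (out X) ⟨
    sumFin (λ a → out W a + out X a)                ≡⟨ sumFin-cong per-arc ⟩
    sumFin (λ a → out (W ∩ X) a + out (W ∪ X) a)    ≡⟨ sumFin-+ (out (W ∩ X)) (out (W ∪ X)) ⟩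
    xout D x (W ∩ X) + xout D x (W ∪ X)             ∎
    where
    open ≡-Reasoning
    out : Subset n → Fin m → ℚ
    out Y a = if leaves? D Y a then x a else 0ℚ
    per-arc : ∀ a → out W a + out X a ≡ out (W ∩ X) a + out (W ∪ X) a
    per-arc a =
      trans (if-leaves-modular (lookup W (tail D a)) (lookup W (head D a)) (lookup X (tail D a)) (lookup X (head D a))
                               (x a) (W-closed a) (X-closed a))
            (sym (cong₂ (λ l₁ l₂ → (if l₁ then x a else 0ℚ) + (if l₂ then x a else 0ℚ)) (leaves-∩ W X a) (leaves-∪ W X a)))

module _ {n m : ℕ} {D : Digraph n m} {𝓕 : Subset n → Set} (U : Subset n) where

  FF-addSet : ∀ {x} → FF D 𝓕 x → xout D x U ≡ 1ℚ → FF D (addSet D 𝓕 U) x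
  FF-addSet (x∈dij , x-tight) x[U]≡1 = x∈dij , λ where
    W (inj₁ W∈𝓕) → x-tight W W∈𝓕
    _ (inj₂ refl) → x[U]≡1

  dicut⇒FBar : IsDicut D U → FBar D 𝓕 U U
  dicut⇒FBar (U-proper , U-closed) = U-proper , U-closed , λ y y∈F → proj₂ y∈F U (inj₂ refl)

  member⇒FBar : IsDigraft D 𝓕 → ∀ {W} → 𝓕 W → FBar D 𝓕 U W
  member⇒FBar (_ , _ , ⊥∉𝓕 , ⊤∉𝓕 , closed , _) {W} W∈𝓕 =
    (nonempty , co-nonempty) , closed W W∈𝓕 , λ y y∈F → proj₂ y∈F W (inj₁ W∈𝓕)
    where
    nonempty : Nonempty W
    nonempty with nonempty? W
    ... | yes ne = ne
    ... | no ¬ne = contradiction (subst 𝓕 (Empty-unique ¬ne) W∈𝓕) ⊥∉𝓕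
    co-nonempty : Nonempty (∁ W)
    co-nonempty with nonempty? (∁ W)
    ... | yes ne = ne
    ... | no ¬ne = contradiction (subst 𝓕 (⊆-antisym ⊆⊤ (λ {v} _ → x∉∁p⇒x∈p (¬ne ∘ (v ,_)))) W∈𝓕) ⊤∉𝓕

  FBar-uncross : ∀ {W X} → FBar D 𝓕 U W → FBar D 𝓕 U X →
                 NonemptyProper D (W ∩ X) → NonemptyProper D (W ∪ X) →
                 FBar D 𝓕 U (W ∩ X) × FBar D 𝓕 U (W ∪ X)
  FBar-uncross {W} {X} (_ , W-closed , W-tight) (_ , X-closed , X-tight) ∩-proper ∪-proper =
    (∩-proper , ∩-closed , λ y → proj₁ ∘ uncrossed y) , (∪-proper , ∪-closed , λ y → proj₂ ∘ uncrossed y)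
    where
    ∩-closed : NoEntering D (W ∩ X)
    ∩-closed = NoEntering-∩ D W X W-closed X-closed
    ∪-closed : NoEntering D (W ∪ X)
    ∪-closed = NoEntering-∪ D W X W-closed X-closed
    uncrossed : ∀ y → FF D (addSet D 𝓕 U) y → xout D y (W ∩ X) ≡ 1ℚ × xout D y (W ∪ X) ≡ 1ℚ
    uncrossed y y∈F@((_ , dicut-bound) , _) =
      ≡1-of-uncrossingˡ modular (X-tight y y∈F) (W-tight y y∈F) ∩-bound ∪-bound ,
      ≡1-of-uncrossingʳ modular (X-tight y y∈F) (W-tight y y∈F) ∩-bound ∪-bound
      where
      modular : xout D y W + xout D y X ≡ xout D y (W ∩ X) + xout D y (W ∪ X)
      modular = xout-modular D y W X W-closed X-closed
      ∩-bound : 1ℚ ≤ xout D y (W ∩ X)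
      ∩-bound = dicut-bound (W ∩ X) (∩-proper , ∩-closed)
      ∪-bound : 1ℚ ≤ xout D y (W ∪ X)
      ∪-bound = dicut-bound (W ∪ X) (∪-proper , ∪-closed)

module Shrinking {n m n′ m′ : ℕ} {D : Digraph n m} {𝓕 : Subset n → Set} {U S : Subset n}
                 {D′ : Digraph n′ m′} {𝓕′ : Subset n′ → Set}
                 {φ : Fin n → Fin n′} {ψ : Fin m′ → Fin m} {u : Fin n′}
                 (shrinking : IsShrinking D 𝓕 U S D′ 𝓕′ φ ψ u) (S-nonempty : Nonempty S) where

  open IsShrinking shrinking

  φ⁻¹[u]⊆S : ∀ {v} → φ v ≡ u → v ∈ S
  φ⁻¹[u]⊆S {v} φv≡u with v ∈? S
  ... | yes v∈S = v∈S
  ... | no  v∉S = contradiction φv≡u (φ-out v v∉S)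

  φ-surjective : ∀ v′ → ∃ λ v → φ v ≡ v′
  φ-surjective v′ with v′ ≟ᶠ u
  ... | yes refl = let (s , s∈S) = S-nonempty in s , φ-S s s∈S
  ... | no  v′≢u = let (v , _ , φv≡v′) = φ-surj v′ v′≢u in v , φv≡v′

  φ-injective-outside : ∀ {v w} → v ∉ S → φ w ≡ φ v → w ≡ v
  φ-injective-outside {v} {w} v∉S φw≡φv with w ∈? S
  ... | yes w∈S = contradiction (trans (sym φw≡φv) (φ-S w w∈S)) (φ-out v v∉S)
  ... | no  w∉S = φ-inj w v w∉S v∉S φw≡φv

  InsideS : Fin m → Set
  InsideS a = tail D a ∈ S × head D a ∈ S

  arc-cases : ∀ a → (∃ λ b → ψ b ≡ a) ⊎ InsideS a
  arc-cases a with any? (λ b → ψ b ≟ᶠ a)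
  ... | yes in-image = inj₁ in-image
  ... | no  ∉image   = inj₂ (decidable-stable (tail D a ∈? S ×-dec head D a ∈? S) (∉image ∘ from (ψ-image a)))

  preimage : Subset n′ → Subset n
  preimage W′ = tabulate (lookup W′ ∘ φ)

  lookup-preimage : ∀ W′ v → lookup (preimage W′) v ≡ lookup W′ (φ v)
  lookup-preimage W′ = lookup∘tabulate (lookup W′ ∘ φ)

  ∈-preimage⁺ : ∀ {W′ v} → φ v ∈ W′ → v ∈ preimage W′
  ∈-preimage⁺ {W′} {v} φv∈W′ = lookup⇒[]= v (preimage W′) (trans (lookup-preimage W′ v) ([]=⇒lookup φv∈W′))

  ∈-preimage⁻ : ∀ {W′ v} → v ∈ preimage W′ → φ v ∈ W′
  ∈-preimage⁻ {W′} {v} v∈ = lookup⇒[]= (φ v) W′ (trans (sym (lookup-preimage W′ v)) ([]=⇒lookup v∈))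

  leaves-preimage : ∀ W′ b → leaves? D′ W′ b ≡ leaves? D (preimage W′) (ψ b)
  leaves-preimage W′ b = cong₂ (λ t h → t ∧ not h)
    (trans (cong (lookup W′) (tail-ψ b)) (sym (lookup-preimage W′ _)))
    (trans (cong (lookup W′) (head-ψ b)) (sym (lookup-preimage W′ _)))

  enters-preimage : ∀ W′ b → enters? D′ W′ b ≡ enters? D (preimage W′) (ψ b)
  enters-preimage W′ b = cong₂ (λ h t → h ∧ not t)
    (trans (cong (lookup W′) (head-ψ b)) (sym (lookup-preimage W′ _)))
    (trans (cong (lookup W′) (tail-ψ b)) (sym (lookup-preimage W′ _)))

  preimage-constant-on-S : ∀ W′ {v} → v ∈ S → lookup (preimage W′) v ≡ lookup W′ u
  preimage-constant-on-S W′ {v} v∈S = trans (lookup-preimage W′ v) (cong (lookup W′) (φ-S v v∈S))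

  leaves-preimage-inside : ∀ W′ {a} → InsideS a → leaves? D (preimage W′) a ≡ false
  leaves-preimage-inside W′ (t∈S , h∈S) =
    trans (cong₂ (λ t h → t ∧ not h) (preimage-constant-on-S W′ t∈S) (preimage-constant-on-S W′ h∈S))
          (∧-inverseʳ (lookup W′ u))

  enters-preimage-inside : ∀ W′ {a} → InsideS a → enters? D (preimage W′) a ≡ false
  enters-preimage-inside W′ (t∈S , h∈S) =
    trans (cong₂ (λ h t → h ∧ not t) (preimage-constant-on-S W′ h∈S) (preimage-constant-on-S W′ t∈S))
          (∧-inverseʳ (lookup W′ u))

  xout-preimage : ∀ x W′ → xout D′ (x ∘ ψ) W′ ≡ xout D x (preimage W′)
  xout-preimage x W′ =
    trans (sumFin-cong (λ b → cong (λ l → if l then x (ψ b) else 0ℚ) (leaves-preimage W′ b)))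
          (sumFin-reindex ψ (ψ-inj _ _) out vanishes-outside)
    where
    out : Fin m → ℚ
    out a = if leaves? D (preimage W′) a then x a else 0ℚ
    vanishes-outside : ∀ a → (∀ b → ψ b ≢ a) → out a ≡ 0ℚ
    vanishes-outside a ∉image with arc-cases a
    ... | inj₁ (b , ψb≡a) = contradiction ψb≡a (∉image b)
    ... | inj₂ inside     = cong (λ l → if l then x a else 0ℚ) (leaves-preimage-inside W′ inside)

  preimage-NoEntering : ∀ W′ → NoEntering D′ W′ → NoEntering D (preimage W′)
  preimage-NoEntering W′ W′-closed a with arc-cases a
  ... | inj₁ (b , refl) = trans (sym (enters-preimage W′ b)) (W′-closed b)
  ... | inj₂ inside     = enters-preimage-inside W′ inside

  preimage-dicut : ∀ W′ → IsDicut D′ W′ → IsDicut D (preimage W′)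
  preimage-dicut W′ (((w′ , w′∈W′) , (z′ , z′∈∁W′)) , W′-closed) with φ-surjective w′ | φ-surjective z′
  ... | w , refl | z , refl =
    ((w , ∈-preimage⁺ w′∈W′) , (z , x∉p⇒x∈∁p (x∈∁p⇒x∉p z′∈∁W′ ∘ ∈-preimage⁻))) , preimage-NoEntering W′ W′-closed

  _IsImageOf_ : Subset n′ → Subset n → Set
  W′ IsImageOf W = ∀ v′ → v′ ∈ W′ ⇔ (∃ λ v → v ∈ W × φ v ≡ v′)

  Saturated : Subset n → Set
  Saturated W = Empty (W ∩ S) ⊎ S ⊆ W

  image-reflects : ∀ {W W′ v} → Saturated W → W′ IsImageOf W → φ v ∈ W′ → v ∈ W
  image-reflects {W} {W′} {v} saturated W′≡φ[W] φv∈W′ with to (W′≡φ[W] (φ v)) φv∈W′ | v ∈? S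
  ... | w , w∈W , φw≡φv | no  v∉S = subst (_∈ W) (φ-injective-outside v∉S φw≡φv) w∈W
  ... | w , w∈W , φw≡φv | yes v∈S with saturated
  ...   | inj₁ W∩S-empty = contradiction (w , x∈p∩q⁺ (w∈W , φ⁻¹[u]⊆S (trans φw≡φv (φ-S v v∈S)))) W∩S-empty
  ...   | inj₂ S⊆W       = S⊆W v∈S

  image-preserves : ∀ {W W′ v} → W′ IsImageOf W → v ∈ W → φ v ∈ W′
  image-preserves {v = v} W′≡φ[W] v∈W = from (W′≡φ[W] (φ v)) (v , v∈W , refl)

  preimage-image : ∀ {W W′} → Saturated W → W′ IsImageOf W → lookup (preimage W′) ≗ lookup W
  preimage-image {W} {W′} saturated W′≡φ[W] v = ⇔→≡ (mk⇔
    (λ v∈preimage → []=⇒lookup (image-reflects saturated W′≡φ[W] (∈-preimage⁻ (lookup⇒[]= v (preimage W′) v∈preimage))))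
    (λ v∈W → []=⇒lookup (∈-preimage⁺ (image-preserves W′≡φ[W] (lookup⇒[]= v W v∈W)))))

  image-NoEntering : ∀ {W W′} → Saturated W → W′ IsImageOf W → NoEntering D W → NoEntering D′ W′
  image-NoEntering {W} {W′} saturated W′≡φ[W] W-closed b =
    trans (enters-preimage W′ b)
          (NoEntering-cong D {W} {preimage W′} (sym ∘ preimage-image saturated W′≡φ[W]) W-closed (ψ b))

  image-dicut : ∀ {W W′} → Saturated W → W′ IsImageOf W → IsDicut D W → IsDicut D′ W′
  image-dicut saturated W′≡φ[W] (((w , w∈W) , (z , z∈∁W)) , W-closed) =
    ((φ w , image-preserves W′≡φ[W] w∈W) ,
     (φ z , x∉p⇒x∈∁p (x∈∁p⇒x∉p z∈∁W ∘ image-reflects saturated W′≡φ[W]))) ,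
    image-NoEntering saturated W′≡φ[W] W-closed

  FF-restrict : ∀ {x} → FF D (addSet D 𝓕 U) x → FF D′ 𝓕′ (x ∘ ψ)
  FF-restrict {x} x∈F@((x≥0 , dicut-bound) , _) =
    ((x≥0 ∘ ψ) , λ W′ W′-dicut →
      subst (1ℚ ≤_) (sym (xout-preimage x W′)) (dicut-bound (preimage W′) (preimage-dicut W′ W′-dicut))) ,
    λ W′ W′∈𝓕′ → let (W , (_ , _ , W-tight) , saturated , W′≡φ[W]) = to (𝓕'-char W′) W′∈𝓕′ in
      trans (xout-preimage x W′)
            (trans (xout-congʳ D x {preimage W′} {W} (preimage-image saturated W′≡φ[W])) (W-tight x x∈F))

  image? : ∀ W v′ → Dec (∃ λ v → v ∈ W × φ v ≡ v′)
  image? W v′ = any? (λ v → v ∈? W ×-dec φ v ≟ᶠ v′)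

  image : Subset n → Subset n′
  image W = tabulate (λ v′ → isYes (image? W v′))

  image-isImage : ∀ W → image W IsImageOf W
  image-isImage W v′ = mk⇔
    (λ v′∈ → toWitness {a? = image? W v′} (from T-≡ (trans (sym (lookup∘tabulate _ v′)) ([]=⇒lookup v′∈))))
    (λ ∃v → lookup⇒[]= v′ (image W) (trans (lookup∘tabulate _ v′) (to T-≡ (fromWitness {a? = image? W v′} ∃v))))

  ∁⁅⁆-image : ∀ {v} → v ∉ S → ∁ ⁅ φ v ⁆ IsImageOf ∁ ⁅ v ⁆
  ∁⁅⁆-image {v} v∉S z′ = mk⇔
    (λ z′∈ → let (z , φz≡z′) = φ-surjective z′ in
      z , ∈∁⁅⁆⁺ (λ z≡v → ∈∁⁅⁆⁻ z′∈ (trans (sym φz≡z′) (cong φ z≡v))) , φz≡z′)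
    (λ (z , z∈ , φz≡z′) → ∈∁⁅⁆⁺ (λ z′≡φv → ∈∁⁅⁆⁻ z∈ (φ-injective-outside v∉S (trans φz≡z′ z′≡φv))))

  ∁⁅u⁆-image : ∀ {W} → (∀ {v} → v ∉ S → v ∈ W) → (∀ {v} → v ∈ W → v ∉ S) → ∁ ⁅ u ⁆ IsImageOf W
  ∁⁅u⁆-image ∁S⊆W W⊆∁S z′ = mk⇔
    (λ z′∈ → let (z , z∉S , φz≡z′) = φ-surj z′ (∈∁⁅⁆⁻ z′∈) in z , ∁S⊆W z∉S , φz≡z′)
    (λ (z , z∈W , φz≡z′) → ∈∁⁅⁆⁺ (λ z′≡u → φ-out z (W⊆∁S z∈W) (trans φz≡z′ z′≡u)))

  module Lift (x : Fin m → ℚ) {y : Fin m′ → ℚ} (y≗x∘ψ : y ≗ x ∘ ψ) (y∈F′ : FF D′ 𝓕′ y) where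

    xout-image : ∀ {W} → Saturated W → xout D′ y (image W) ≡ xout D x W
    xout-image {W} saturated = begin
      xout D′ y (image W)            ≡⟨ xout-congˡ D′ (image W) y≗x∘ψ ⟩
      xout D′ (x ∘ ψ) (image W)      ≡⟨ xout-preimage x (image W) ⟩
      xout D x (preimage (image W))  ≡⟨ xout-congʳ D x {preimage (image W)} {W} (preimage-image saturated (image-isImage W)) ⟩
      xout D x W                     ∎
      where open ≡-Reasoning

    saturated-dicut-bound : ∀ {W} → Saturated W → IsDicut D W → 1ℚ ≤ xout D x W
    saturated-dicut-bound {W} saturated W-dicut =
      subst (1ℚ ≤_) (xout-image saturated) (proj₂ (proj₁ y∈F′) (image W) (image-dicut saturated (image-isImage W) W-dicut))

    saturated-FBar-tight : ∀ {W} → Saturated W → FBar D 𝓕 U W → xout D x W ≡ 1ℚ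
    saturated-FBar-tight {W} saturated W∈𝓕̄ =
      trans (sym (xout-image saturated))
            (proj₂ y∈F′ (image W) (from (𝓕'-char (image W)) (W , W∈𝓕̄ , saturated , image-isImage W)))

  private
    restart : ∀ {P′ v₁ v₂ w} → v₁ ≡ v₂ → Walk D′ P′ v₁ w → Walk D′ P′ v₂ w
    restart refl walk = walk

  walk-image : ∀ {P : Fin m → Set} {P′ : Fin m′ → Set} → (∀ b → P (ψ b) → P′ b) →
               ∀ {v w} → Walk D P v w → Walk D′ P′ (φ v) (φ w)
  walk-image P⇒P′ (here v) = here (φ v)
  walk-image P⇒P′ (fwd a Pa rest) with arc-cases a
  ... | inj₁ (b , refl)  = restart (tail-ψ b) (fwd b (P⇒P′ b Pa) (restart (sym (head-ψ b)) (walk-image P⇒P′ rest)))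
  ... | inj₂ (t∈S , h∈S) = restart (trans (φ-S _ h∈S) (sym (φ-S _ t∈S))) (walk-image P⇒P′ rest)
  walk-image P⇒P′ (bwd a Pa rest) with arc-cases a
  ... | inj₁ (b , refl)  = restart (head-ψ b) (bwd b (P⇒P′ b Pa) (restart (sym (tail-ψ b)) (walk-image P⇒P′ rest)))
  ... | inj₂ (t∈S , h∈S) = restart (trans (φ-S _ t∈S) (sym (φ-S _ h∈S))) (walk-image P⇒P′ rest)

  connected-image : ∀ {P : Fin m → Set} {P′ : Fin m′ → Set} → (∀ b → P (ψ b) → P′ b) →
                    (∀ v w → Walk D P v w) → ∀ v′ w′ → Walk D′ P′ v′ w′
  connected-image P⇒P′ connected v′ w′ with φ-surjective v′ | φ-surjective w′
  ... | v , refl | w , refl = walk-image P⇒P′ (connected v w)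

  TwoEdgeConnected-image : TwoEdgeConnected D → TwoEdgeConnected D′
  TwoEdgeConnected-image (connected , bridgeless) =
    connected-image (λ _ _ → tt) connected ,
    λ e → connected-image (λ b ψb≢ψe b≡e → ψb≢ψe (cong ψ b≡e)) (bridgeless (ψ e))

  IsDigraft-shrink : IsDigraft D 𝓕 → ∀ {x} → FF D (addSet D 𝓕 U) x →
                     IsSource D′ u ⊎ IsSink D′ u → (IsSink D′ u → 𝓕′ (∁ ⁅ u ⁆)) → IsDigraft D′ 𝓕′
  IsDigraft-shrink digraft@(bipartite , twoEdgeConnected , _ , _ , _ , sinks∈𝓕 , _) x∈F u-bipartite u-sink⇒∈𝓕′ =
    bipartite′ , TwoEdgeConnected-image twoEdgeConnected , ⊥∉𝓕′ , ⊤∉𝓕′ , 𝓕′-closed , sinks∈𝓕′ , (_ , FF-restrict x∈F)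
    where
    bipartite′ : Bipartite D′
    bipartite′ v′ with v′ ≟ᶠ u
    ... | yes refl = u-bipartite
    ... | no v′≢u with φ-surj v′ v′≢u
    ...   | v , v∉S , refl with bipartite v
    ...     | inj₁ source = inj₁ (λ b head≡φv → source (ψ b) (φ-injective-outside v∉S (trans (sym (head-ψ b)) head≡φv)))
    ...     | inj₂ sink   = inj₂ (λ b tail≡φv → sink (ψ b) (φ-injective-outside v∉S (trans (sym (tail-ψ b)) tail≡φv)))

    ⊥∉𝓕′ : ¬ 𝓕′ ⊥
    ⊥∉𝓕′ ⊥∈𝓕′ with to (𝓕'-char ⊥) ⊥∈𝓕′
    ... | W , (((w , w∈W) , _) , _) , _ , ⊥≡φ[W] = ∉⊥ (image-preserves ⊥≡φ[W] w∈W)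

    ⊤∉𝓕′ : ¬ 𝓕′ ⊤
    ⊤∉𝓕′ ⊤∈𝓕′ with to (𝓕'-char ⊤) ⊤∈𝓕′
    ... | W , ((_ , (z , z∈∁W)) , _) , saturated , ⊤≡φ[W] = x∈∁p⇒x∉p z∈∁W (image-reflects saturated ⊤≡φ[W] ∈⊤)

    𝓕′-closed : ∀ W′ → 𝓕′ W′ → NoEntering D′ W′
    𝓕′-closed W′ W′∈𝓕′ with to (𝓕'-char W′) W′∈𝓕′
    ... | W , (_ , W-closed , _) , saturated , W′≡φ[W] = image-NoEntering saturated W′≡φ[W] W-closed

    sinks∈𝓕′ : ∀ v′ → IsSink D′ v′ → 𝓕′ (∁ ⁅ v′ ⁆)
    sinks∈𝓕′ v′ v′-sink with v′ ≟ᶠ u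
    ... | yes refl = u-sink⇒∈𝓕′ v′-sink
    ... | no v′≢u with φ-surj v′ v′≢u
    ...   | v , v∉S , refl =
      from (𝓕'-char _) (∁ ⁅ v ⁆ , member⇒FBar U digraft (sinks∈𝓕 v v-sink) , inj₂ S⊆∁⁅v⁆ , ∁⁅⁆-image v∉S)
      where
      v-sink : IsSink D v
      v-sink a tail≡v with from (ψ-image a) (λ (t∈S , _) → v∉S (subst (_∈ S) tail≡v t∈S))
      ... | b , refl = v′-sink b (trans (tail-ψ b) (cong φ tail≡v))
      S⊆∁⁅v⁆ : S ⊆ ∁ ⁅ v ⁆
      S⊆∁⁅v⁆ s∈S = ∈∁⁅⁆⁺ (λ s≡v → v∉S (subst (_∈ S) s≡v s∈S))

module Contraction
  {n m : ℕ} {D : Digraph n m} {𝓕 : Subset n → Set} {U : Subset n}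
  (digraft : IsDigraft D 𝓕) (U-dicut : IsDicut D U) (U-tight : ∃ λ x → FF D 𝓕 x × xout D x U ≡ 1ℚ)
  {n₁ m₁ n₂ m₂ : ℕ}
  {D₁ : Digraph n₁ m₁} {𝓕₁ : Subset n₁ → Set} {φ₁ : Fin n → Fin n₁} {ψ₁ : Fin m₁ → Fin m} {u₁ : Fin n₁}
  {D₂ : Digraph n₂ m₂} {𝓕₂ : Subset n₂ → Set} {φ₂ : Fin n → Fin n₂} {ψ₂ : Fin m₂ → Fin m} {u₂ : Fin n₂}
  (shrinking₁ : IsShrinking D 𝓕 U U D₁ 𝓕₁ φ₁ ψ₁ u₁)
  (shrinking₂ : IsShrinking D 𝓕 U (∁ U) D₂ 𝓕₂ φ₂ ψ₂ u₂) where

  private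
    U-closed : NoEntering D U
    U-closed = proj₂ U-dicut

    U∈𝓕̄ : FBar D 𝓕 U U
    U∈𝓕̄ = dicut⇒FBar U U-dicut

    module I₁ = IsShrinking shrinking₁
    module I₂ = IsShrinking shrinking₂
    module S₁ = Shrinking shrinking₁ (proj₁ (proj₁ U-dicut))
    module S₂ = Shrinking shrinking₂ (proj₂ (proj₁ U-dicut))

    x₀ : Fin m → ℚ
    x₀ = proj₁ U-tight

    x₀[U]≡1 : xout D x₀ U ≡ 1ℚ
    x₀[U]≡1 = proj₂ (proj₂ U-tight)

    x₀∈F[𝓕∪U] : FF D (addSet D 𝓕 U) x₀
    x₀∈F[𝓕∪U] = FF-addSet U (proj₁ (proj₂ U-tight)) x₀[U]≡1

    U∩∁U-empty : Empty (U ∩ ∁ U)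
    U∩∁U-empty (v , v∈U∩∁U) = let (v∈U , v∈∁U) = x∈p∩q⁻ U (∁ U) v∈U∩∁U in x∈∁p⇒x∉p v∈∁U v∈U

  u₁-source : IsSource D₁ u₁
  u₁-source b head≡u₁ = to (I₁.ψ-image (ψ₁ b)) (b , refl) (NoEntering-head⇒tail D U-closed head∈U , head∈U)
    where
    head∈U : head D (ψ₁ b) ∈ U
    head∈U = S₁.φ⁻¹[u]⊆S (trans (sym (I₁.head-ψ b)) head≡u₁)

  u₁-not-sink : ¬ IsSink D₁ u₁
  u₁-not-sink u₁-sink with leaving-arc D x₀ U (λ x₀[U]≡0 → 1≢0 (trans (sym x₀[U]≡1) x₀[U]≡0))
  ... | a , leaves with leaves?⁻ D leaves
  ...   | tail∈U , head∉U with from (I₁.ψ-image a) (head∉U ∘ proj₂)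
  ...     | b , refl = u₁-sink b (trans (I₁.tail-ψ b) (I₁.φ-S _ tail∈U))

  u₂-sink : IsSink D₂ u₂
  u₂-sink b tail≡u₂ =
    to (I₂.ψ-image (ψ₂ b)) (b , refl) (tail∈∁U , x∉p⇒x∈∁p (x∈∁p⇒x∉p tail∈∁U ∘ NoEntering-head⇒tail D U-closed))
    where
    tail∈∁U : tail D (ψ₂ b) ∈ ∁ U
    tail∈∁U = S₂.φ⁻¹[u]⊆S (trans (sym (I₂.tail-ψ b)) tail≡u₂)

  ∁⁅u₂⁆∈𝓕₂ : 𝓕₂ (∁ ⁅ u₂ ⁆)
  ∁⁅u₂⁆∈𝓕₂ = from (I₂.𝓕'-char _) (U , U∈𝓕̄ , inj₁ U∩∁U-empty , S₂.∁⁅u⁆-image x∉∁p⇒x∈p x∈p⇒x∉∁p)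

  digraft₁ : IsDigraft D₁ 𝓕₁
  digraft₁ = S₁.IsDigraft-shrink digraft x₀∈F[𝓕∪U] (inj₁ u₁-source) (⊥-elim ∘ u₁-not-sink)

  digraft₂ : IsDigraft D₂ 𝓕₂
  digraft₂ = S₂.IsDigraft-shrink digraft x₀∈F[𝓕∪U] (inj₂ u₂-sink) (λ _ → ∁⁅u₂⁆∈𝓕₂)

  decompose : ∀ {x} → FF D 𝓕 x → xout D x U ≡ 1ℚ → FF D₁ 𝓕₁ (x ∘ ψ₁) × FF D₂ 𝓕₂ (x ∘ ψ₂)
  decompose x∈F x[U]≡1 = S₁.FF-restrict (FF-addSet U x∈F x[U]≡1) , S₂.FF-restrict (FF-addSet U x∈F x[U]≡1)

  crossing-cases : ∀ {W} → NonemptyProper D W →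
                   S₁.Saturated W ⊎ S₂.Saturated W ⊎ (NonemptyProper D (W ∩ U) × NonemptyProper D (W ∪ U))
  crossing-cases {W} ((w , w∈W) , _) with nonempty? (W ∩ U) | nonempty? (∁ (W ∪ U))
  ... | no  W∩U-empty    | _                 = inj₁ (inj₁ W∩U-empty)
  ... | yes _            | no  ∁[W∪U]-empty  = inj₂ (inj₁ (inj₂ ∁U⊆W))
    where
    ∁U⊆W : ∁ U ⊆ W
    ∁U⊆W {v} v∈∁U = decidable-stable (v ∈? W) λ v∉W →
      ∁[W∪U]-empty (v , x∉p⇒x∈∁p (λ v∈W∪U → [ v∉W , x∈∁p⇒x∉p v∈∁U ]′ (x∈p∪q⁻ W U v∈W∪U)))
  ... | yes W∩U-nonempty | yes ∁[W∪U]-nonempty =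
    inj₂ (inj₂ ((W∩U-nonempty , (s₂ , s₂∈∁[W∩U])) , ((w , p⊆p∪q U w∈W) , ∁[W∪U]-nonempty)))
    where
    s₂ : Fin n
    s₂ = proj₁ (proj₂ (proj₁ U-dicut))
    s₂∈∁[W∩U] : s₂ ∈ ∁ (W ∩ U)
    s₂∈∁[W∩U] = x∉p⇒x∈∁p (x∈∁p⇒x∉p (proj₂ (proj₂ (proj₁ U-dicut))) ∘ proj₂ ∘ x∈p∩q⁻ W U)

  ∩-saturated₂ : ∀ W → S₂.Saturated (W ∩ U)
  ∩-saturated₂ W = inj₁ λ (v , v∈) → let (v∈W∩U , v∈∁U) = x∈p∩q⁻ (W ∩ U) (∁ U) v∈ in
    x∈∁p⇒x∉p v∈∁U (proj₂ (x∈p∩q⁻ W U v∈W∩U))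

  ∪-saturated₁ : ∀ W → S₁.Saturated (W ∪ U)
  ∪-saturated₁ W = inj₂ (q⊆p∪q W U)

  compose : ∀ x {y₁ y₂} → y₁ ≗ x ∘ ψ₁ → y₂ ≗ x ∘ ψ₂ → FF D₁ 𝓕₁ y₁ → FF D₂ 𝓕₂ y₂ →
            FF D 𝓕 x × xout D x U ≡ 1ℚ
  compose x y₁≗x∘ψ₁ y₂≗x∘ψ₂ y₁∈F₁ y₂∈F₂ = ((x≥0 , dicut-bound) , tight) , x[U]≡1
    where
    module L₁ = S₁.Lift x y₁≗x∘ψ₁ y₁∈F₁
    module L₂ = S₂.Lift x y₂≗x∘ψ₂ y₂∈F₂

    x≥0 : ∀ a → 0ℚ ≤ x a
    x≥0 a with S₁.arc-cases a
    ... | inj₁ (b , refl) = subst (0ℚ ≤_) (y₁≗x∘ψ₁ b) (proj₁ (proj₁ y₁∈F₁) b)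
    ... | inj₂ (t∈U , _) with from (I₂.ψ-image a) (x∈p⇒x∉∁p t∈U ∘ proj₁)
    ...   | b , refl = subst (0ℚ ≤_) (y₂≗x∘ψ₂ b) (proj₁ (proj₁ y₂∈F₂) b)

    x[U]≡1 : xout D x U ≡ 1ℚ
    x[U]≡1 = L₂.saturated-FBar-tight (inj₁ U∩∁U-empty) U∈𝓕̄

    dicut-bound : ∀ W → IsDicut D W → 1ℚ ≤ xout D x W
    dicut-bound W W-dicut@(W-proper , W-closed) with crossing-cases W-proper
    ... | inj₁ saturated₁        = L₁.saturated-dicut-bound saturated₁ W-dicut
    ... | inj₂ (inj₁ saturated₂) = L₂.saturated-dicut-bound saturated₂ W-dicut
    ... | inj₂ (inj₂ (∩-proper , ∪-proper)) =
      1≤-of-uncrossing (xout-modular D x W U W-closed U-closed) x[U]≡1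
        (L₂.saturated-dicut-bound (∩-saturated₂ W) (∩-proper , NoEntering-∩ D W U W-closed U-closed))
        (L₁.saturated-dicut-bound (∪-saturated₁ W) (∪-proper , NoEntering-∪ D W U W-closed U-closed))

    tight : ∀ W → 𝓕 W → xout D x W ≡ 1ℚ
    tight W W∈𝓕 with member⇒FBar U digraft W∈𝓕
    ... | W∈𝓕̄@(W-proper , W-closed , _) with crossing-cases W-proper
    ...   | inj₁ saturated₁        = L₁.saturated-FBar-tight saturated₁ W∈𝓕̄
    ...   | inj₂ (inj₁ saturated₂) = L₂.saturated-FBar-tight saturated₂ W∈𝓕̄
    ...   | inj₂ (inj₂ (∩-proper , ∪-proper)) =
      let (W∩U∈𝓕̄ , W∪U∈𝓕̄) = FBar-uncross U W∈𝓕̄ U∈𝓕̄ ∩-proper ∪-proper in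
      ≡1-of-uncrossing (xout-modular D x W U W-closed U-closed) x[U]≡1
        (L₂.saturated-FBar-tight (∩-saturated₂ W) W∩U∈𝓕̄)
        (L₁.saturated-FBar-tight (∪-saturated₁ W) W∪U∈𝓕̄)

  shared-arc-leaves-U : ∀ {b₁ b₂} → ψ₁ b₁ ≡ ψ₂ b₂ → leaves? D U (ψ₁ b₁) ≡ true
  shared-arc-leaves-U {b₁} {b₂} ψ₁b₁≡ψ₂b₂ = leaves?⁺ D tail∈U head∉U
    where
    not-inside-U : ¬ (tail D (ψ₁ b₁) ∈ U × head D (ψ₁ b₁) ∈ U)
    not-inside-U = to (I₁.ψ-image (ψ₁ b₁)) (b₁ , refl)
    not-inside-∁U : ¬ (tail D (ψ₁ b₁) ∈ ∁ U × head D (ψ₁ b₁) ∈ ∁ U)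
    not-inside-∁U = to (I₂.ψ-image (ψ₁ b₁)) (b₂ , sym ψ₁b₁≡ψ₂b₂)
    head∉U : head D (ψ₁ b₁) ∉ U
    head∉U head∈U = not-inside-U (NoEntering-head⇒tail D U-closed head∈U , head∈U)
    tail∈U : tail D (ψ₁ b₁) ∈ U
    tail∈U = x∉∁p⇒x∈p (λ tail∈∁U → not-inside-∁U (tail∈∁U , x∉p⇒x∈∁p head∉U))

  module Union (J₁ : Subset m₁) (J₂ : Subset m₂)
    (agree : ∀ b₁ b₂ → ψ₁ b₁ ≡ ψ₂ b₂ → leaves? D U (ψ₁ b₁) ≡ true → lookup J₁ b₁ ≡ lookup J₂ b₂)
    (J : Subset m)
    (J≡J₁∪J₂ : ∀ a → a ∈ J ⇔ ((∃ λ b₁ → ψ₁ b₁ ≡ a × b₁ ∈ J₁) ⊎ (∃ λ b₂ → ψ₂ b₂ ≡ a × b₂ ∈ J₂))) where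

    agree-shared : ∀ {b₁ b₂} → ψ₁ b₁ ≡ ψ₂ b₂ → lookup J₁ b₁ ≡ lookup J₂ b₂
    agree-shared ψ₁b₁≡ψ₂b₂ = agree _ _ ψ₁b₁≡ψ₂b₂ (shared-arc-leaves-U ψ₁b₁≡ψ₂b₂)

    ∈J⇒ : ∀ {a} → a ∈ J → (∃ λ b₁ → ψ₁ b₁ ≡ a × b₁ ∈ J₁) ⊎ (∃ λ b₂ → ψ₂ b₂ ≡ a × b₂ ∈ J₂)
    ∈J⇒ = to (J≡J₁∪J₂ _)

    lookup-ψ₁ : ∀ b₁ → lookup J (ψ₁ b₁) ≡ lookup J₁ b₁
    lookup-ψ₁ b₁ = ⇔→≡ (mk⇔
      (λ ψ₁b₁∈J → case ∈J⇒ (lookup⇒[]= _ J ψ₁b₁∈J) of λ where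
        (inj₁ (c , ψ₁c≡ψ₁b₁ , c∈J₁)) → []=⇒lookup (subst (_∈ J₁) (I₁.ψ-inj c b₁ ψ₁c≡ψ₁b₁) c∈J₁)
        (inj₂ (c , ψ₂c≡ψ₁b₁ , c∈J₂)) → trans (agree-shared (sym ψ₂c≡ψ₁b₁)) ([]=⇒lookup c∈J₂))
      (λ b₁∈J₁ → []=⇒lookup (from (J≡J₁∪J₂ _) (inj₁ (b₁ , refl , lookup⇒[]= b₁ J₁ b₁∈J₁)))))

    lookup-ψ₂ : ∀ b₂ → lookup J (ψ₂ b₂) ≡ lookup J₂ b₂
    lookup-ψ₂ b₂ = ⇔→≡ (mk⇔
      (λ ψ₂b₂∈J → case ∈J⇒ (lookup⇒[]= _ J ψ₂b₂∈J) of λ where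
        (inj₁ (c , ψ₁c≡ψ₂b₂ , c∈J₁)) → trans (sym (agree-shared ψ₁c≡ψ₂b₂)) ([]=⇒lookup c∈J₁)
        (inj₂ (c , ψ₂c≡ψ₂b₂ , c∈J₂)) → []=⇒lookup (subst (_∈ J₂) (I₂.ψ-inj c b₂ ψ₂c≡ψ₂b₂) c∈J₂))
      (λ b₂∈J₂ → []=⇒lookup (from (J≡J₁∪J₂ _) (inj₂ (b₂ , refl , lookup⇒[]= b₂ J₂ b₂∈J₂)))))

    indicator-ψ₁ : indicator J₁ ≗ indicator J ∘ ψ₁
    indicator-ψ₁ b₁ = cong (λ t → if t then 1ℚ else 0ℚ) (sym (lookup-ψ₁ b₁))

    indicator-ψ₂ : indicator J₂ ≗ indicator J ∘ ψ₂
    indicator-ψ₂ b₂ = cong (λ t → if t then 1ℚ else 0ℚ) (sym (lookup-ψ₂ b₂))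

-- The size bounds in Contractible only make both contractions smaller than D.
mainTheorem18 : {n m : ℕ} (D : Digraph n m) (𝓕 : Subset n → Set) (U : Subset n) →
    IsDigraft D 𝓕 → Contractible D 𝓕 U →
    {n₁ m₁ n₂ m₂ : ℕ}
    (D₁ : Digraph n₁ m₁) (𝓕₁ : Subset n₁ → Set)
    (φ₁ : Fin n → Fin n₁) (ψ₁ : Fin m₁ → Fin m) (u₁ : Fin n₁)
    (D₂ : Digraph n₂ m₂) (𝓕₂ : Subset n₂ → Set)
    (φ₂ : Fin n → Fin n₂) (ψ₂ : Fin m₂ → Fin m) (u₂ : Fin n₂) →
    IsShrinking D 𝓕 U U D₁ 𝓕₁ φ₁ ψ₁ u₁ →
    IsShrinking D 𝓕 U (∁ U) D₂ 𝓕₂ φ₂ ψ₂ u₂ →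
    -- (1) decomposition
    (IsDigraft D₁ 𝓕₁ × IsDigraft D₂ 𝓕₂ ×
      ((J : Subset m) → FF D 𝓕 (indicator J) → xout D (indicator J) U ≡ 1ℚ →
        FF D₁ 𝓕₁ (λ b → indicator J (ψ₁ b)) × FF D₂ 𝓕₂ (λ b → indicator J (ψ₂ b))))
    ×
    -- (2) composition
    ((J₁ : Subset m₁) (J₂ : Subset m₂) →
      FF D₁ 𝓕₁ (indicator J₁) → FF D₂ 𝓕₂ (indicator J₂) →
      ((b₁ : Fin m₁) (b₂ : Fin m₂) → ψ₁ b₁ ≡ ψ₂ b₂ → leaves? D U (ψ₁ b₁) ≡ true →
        lookup J₁ b₁ ≡ lookup J₂ b₂) →
      (J : Subset m) →
      ((a : Fin m) → a ∈ J ⇔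
        ((∃ λ b₁ → ψ₁ b₁ ≡ a × b₁ ∈ J₁) ⊎ (∃ λ b₂ → ψ₂ b₂ ≡ a × b₂ ∈ J₂))) →
      FF D 𝓕 (indicator J) × xout D (indicator J) U ≡ 1ℚ)
mainTheorem18 D 𝓕 U digraft (U-dicut , _ , _ , U-tight)
              D₁ 𝓕₁ φ₁ ψ₁ u₁ D₂ 𝓕₂ φ₂ ψ₂ u₂ shrinking₁ shrinking₂ =
  (digraft₁ , digraft₂ , λ _ → decompose) ,
  λ J₁ J₂ J₁∈F₁ J₂∈F₂ agree J J≡J₁∪J₂ →
    let open Union J₁ J₂ agree J J≡J₁∪J₂ in compose (indicator J) indicator-ψ₁ indicator-ψ₂ J₁∈F₁ J₂∈F₂
  where open Contraction digraft U-dicut U-tight shrinking₁ shrinking₂
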